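{- Let $d\ge3$ and $F\in\mathrm{Bin}(d,\mathbb{Z})$. Assume that $\mathrm{Aut}(F,\mathbb{Z})=\{\gamma\in\mathrm{GL}(2,\mathbb{Z}):F\circ\gamma=F\}$ contains an element of order $3$. Then the forms $F(X,Y)$, $F(2X,Y)$ and $F(X,2Y)$ all have the same value set on $\mathbb{Z}^2$. Furthermore, there is no $\gamma\in\mathrm{GL}(2,\mathbb{Z})$ with $F(2X,Y)=(F\circ\gamma)(X,Y)$, but there exists $\gamma\in\mathrm{GL}(2,\mathbb{Z})$ with $F(X,2Y)=(G_1\circ\gamma)(X,Y)$, where $G_1(X,Y)=F(2X,Y)$.
   Context: $\mathrm{Bin}(d,\mathbb{Z})$ is the set of binary forms of degree $d$ with integer coefficients and nonzero discriminant. For $\gamma=\begin{pmatrix} a&b\\ c&e\end{pmatrix}$, $(F\circ\gamma)(X,Y)=F(aX+bY,cX+eY)$. The value set of a form $G$ is $G(\mathbb{Z}^2)=\{G(x,y):(x,y)\in\mathbb{Z}^2\}$. -}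

module Defs where

open import Data.Nat as ℕ using (ℕ; zero; suc; NonZero)
import Data.Nat.Properties as ℕP
open import Data.Integer using (ℤ; +_; _+_; _*_; -_; _-_; _^_; _/ℕ_; 0ℤ; 1ℤ; -1ℤ)
open import Data.Fin using (Fin; toℕ; punchIn) renaming (zero to fz; suc to fs)
open import Data.Vec using (Vec; toList)
open import Data.List using (List; []; _∷_; length; map)
open import Data.Product using (_×_; ∃; ∃-syntax)
open import Data.Sum using (_⊎_)
open import Data.Bool using (if_then_else_)
open import Relation.Nullary using (¬_)
open import Relation.Nullary.Decidable using (⌊_⌋)
open import Relation.Binary.PropositionalEquality using (_≡_)

-- A form of degree k is represented by its coefficient
-- list  [c₀ , c₁ , … , c_k]  of length k+1, meaning
--   Σ_j  c_j X^(k-j) Y^j .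
-- (Forms in Bin(d,ℤ) are given as  Vec ℤ (suc d)  and converted with toList.)

evalF : List ℤ → ℤ → ℤ → ℤ
evalF []       x y = 0ℤ
evalF (c ∷ cs) x y = c * x ^ length cs + y * evalF cs x y

-- polynomial (coefficient list) arithmetic, no trimming of zeros
infixl 6 _+ₚ_
_+ₚ_ : List ℤ → List ℤ → List ℤ
[]       +ₚ q        = q
(a ∷ p)  +ₚ []       = a ∷ p
(a ∷ p)  +ₚ (b ∷ q)  = (a + b) ∷ (p +ₚ q)

scaleₚ : ℤ → List ℤ → List ℤ
scaleₚ a p = map (a *_) p

mulₚ : List ℤ → List ℤ → List ℤ
mulₚ _       []       = []
mulₚ []      (_ ∷ _)  = []
mulₚ (a ∷ p) (b ∷ q)  = scaleₚ a (b ∷ q) +ₚ (0ℤ ∷ mulₚ p (b ∷ q))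

powₚ : List ℤ → ℕ → List ℤ
powₚ L zero    = 1ℤ ∷ []
powₚ L (suc n) = mulₚ L (powₚ L n)

-- 2×2 integer matrices  ( a b ; c e )

record Mat : Set where
  constructor mat
  field
    a b c e : ℤ
open Mat public

_·_ : Mat → Mat → Mat
mat a₁ b₁ c₁ e₁ · mat a₂ b₂ c₂ e₂ =
  mat (a₁ * a₂ + b₁ * c₂) (a₁ * b₂ + b₁ * e₂) (c₁ * a₂ + e₁ * c₂) (c₁ * b₂ + e₁ * e₂)

I₂ : Mat
I₂ = mat 1ℤ 0ℤ 0ℤ 1ℤ

det₂ : Mat → ℤ
det₂ (mat a b c e) = a * e - b * c

InGL2 : Mat → Set
InGL2 γ = (det₂ γ ≡ 1ℤ) ⊎ (det₂ γ ≡ -1ℤ)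

HasOrder3 : Mat → Set
HasOrder3 γ = (γ · (γ · γ) ≡ I₂) × ¬ (γ ≡ I₂) × ¬ (γ · γ ≡ I₂)

-- (F ∘ γ)(X,Y) = F(aX+bY, cX+eY), computed coefficientwise:
--   Σ_j c_j (aX+bY)^(k-j) (cX+eY)^j
_∘F_ : List ℤ → Mat → List ℤ
[]       ∘F γ = []
(c₀ ∷ cs) ∘F γ =
  scaleₚ c₀ (powₚ (a γ ∷ b γ ∷ []) (length cs))
    +ₚ mulₚ (c γ ∷ e γ ∷ []) (cs ∘F γ)

-- coefficient i of a form given as a vector (0 outside the range)
coeff : ∀ {d} → Vec ℤ (suc d) → ℕ → ℤ
coeff F i = lookupL (toList F) i
  where
  lookupL : List ℤ → ℕ → ℤ
  lookupL []       _       = 0ℤ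
  lookupL (x ∷ xs) zero    = x
  lookupL (x ∷ xs) (suc i) = lookupL xs i

-- coefficients of ∂F/∂X and ∂F/∂Y (forms of degree d-1)
coeffFX : ∀ {d} → Vec ℤ (suc d) → ℕ → ℤ
coeffFX {d} F i = + (d ℕ.∸ i) * coeff F i

coeffFY : ∀ {d} → Vec ℤ (suc d) → ℕ → ℤ
coeffFY F i = + (suc i) * coeff F (suc i)

sumFin : ∀ n → (Fin n → ℤ) → ℤ
sumFin zero    f = 0ℤ
sumFin (suc n) f = f fz + sumFin n (λ j → f (fs j))

sgn : ℕ → ℤ
sgn zero    = 1ℤ
sgn (suc n) = - sgn n

det : ∀ n → (Fin n → Fin n → ℤ) → ℤ
det zero    M = 1ℤ
det (suc n) M =
  sumFin (suc n) (λ j → sgn (toℕ j) * M fz j * det n (λ r s → M (fs r) (punchIn j s)))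

sylvester : (m n : ℕ) → (ℕ → ℤ) → (ℕ → ℤ) → Fin (m ℕ.+ n) → Fin (m ℕ.+ n) → ℤ
sylvester m n P Q r s =
  if ⌊ toℕ r ℕ.<? n ⌋
  then shifted P (toℕ r)
  else shifted Q (toℕ r ℕ.∸ n)
  where
  shifted : (ℕ → ℤ) → ℕ → ℤ
  shifted R k = if ⌊ k ℕ.≤? toℕ s ⌋ then R (toℕ s ℕ.∸ k) else 0ℤ

res : (m n : ℕ) → (ℕ → ℤ) → (ℕ → ℤ) → ℤ
res m n P Q = det (m ℕ.+ n) (sylvester m n P Q)

nz : ∀ d → NonZero (d ℕ.^ (d ℕ.∸ 2))
nz zero             = _
nz (suc zero)       = _
nz (suc (suc k))    = ℕP.m^n≢0 (suc (suc k)) k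

-- Disc(F) defined through the classical identity
--   Res(F_X, F_Y) = (-1)^(d(d-1)/2) d^(d-2) Disc(F)
disc : ∀ {d} → Vec ℤ (suc d) → ℤ
disc {d} F =
  (sgn ((d ℕ.* (d ℕ.∸ 1)) ℕ./ 2) * res (d ℕ.∸ 1) (d ℕ.∸ 1) (coeffFX F) (coeffFY F))
    /ℕ (d ℕ.^ (d ℕ.∸ 2))
  where instance _ = nz d

InValues : List ℤ → ℤ → Set
InValues G n = ∃[ x ] ∃[ y ] evalF G x y ≡ n

SameValueSet : List ℤ → List ℤ → Set
SameValueSet G H = ∀ n → (InValues G n → InValues H n) × (InValues H n → InValues G n)

{-# OPTIONS --safe #-}
module Submission where

open import Defs
open import Data.Nat as ℕ using (ℕ; zero; suc; _≤_; s≤s)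
import Data.Nat.Properties as ℕP
import Data.Nat.Divisibility as ℕD
import Data.Nat.DivMod as ℕDM
open import Data.Integer as ℤ using (ℤ; 0ℤ; 1ℤ; -1ℤ; +_; -[1+_]; _+_; _*_; -_; _-_; _^_; ∣_∣; _/ℕ_)
import Data.Integer.Properties as ℤP
import Data.Integer.DivMod as ℤDM
open import Data.Integer.Divisibility.Signed
  using (_∣_; divides; ∣⇒∣ᵤ; ∣-refl; ∣m∣n⇒∣m+n; ∣m∣n⇒∣m-n; ∣m⇒∣m*n; ∣n⇒∣m*n)
open import Data.Integer.Tactic.RingSolver using (solve-∀)
open import Algebra.Properties.AbelianGroup ℤP.+-0-abelianGroup
  using () renaming (∙-cancelˡ to +-cancelˡ; ∙-cancelʳ to +-cancelʳ)
open import Data.List using (List; []; _∷_; length; replicate)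
import Data.List.Properties as ListP
open import Data.Vec using (Vec; toList; []; _∷_)
import Data.Vec.Properties as VecP
open import Data.Fin using (Fin; toℕ; punchIn) renaming (zero to fzero; suc to fsuc)
open import Data.Product using (_×_; _,_; proj₁; proj₂; ∃-syntax)
open import Data.Sum using (_⊎_; inj₁; inj₂)
open import Relation.Nullary using (¬_; contradiction; yes; no)
open import Relation.Binary.PropositionalEquality
  using (_≡_; _≢_; refl; sym; trans; cong; cong₂; subst; module ≡-Reasoning)

open ≡-Reasoning

-- An element ρ of order 3 in GL(2,ℤ) has trace -1 and determinant 1, so ρ² = ρ⁻¹ = -I - ρ and for
-- every linear form ℓ the values ℓ(w), ℓ(ρw), ℓ(ρ²w) sum to 0: one of them is even.  As F is
-- ρ-invariant, every value of F is therefore taken on ℤ × 2ℤ and on 2ℤ × ℤ, which gives both equalities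
-- of value sets.  One of ρ, ρ⁻¹ has an even top-left entry 2a′, and for such an automorphism σ one has
-- σ · diag(1,2) = diag(2,1) · γ with γ ∈ GL(2,ℤ), whence F(X,2Y) = F(2X,Y) ∘ γ.  Finally, if
-- F(2X,Y) = F ∘ γ, then choosing ℓ to be the second coordinate of γ⁻¹ shows that every value of F is
-- taken on 2ℤ × 2ℤ, hence by homogeneity is divisible by every power of 2; so F = 0 and disc F = 0.

length-scaleₚ : ∀ k L → length (scaleₚ k L) ≡ length L
length-scaleₚ k = ListP.length-map (k *_)

evalF-scaleₚ : ∀ k L x y → evalF (scaleₚ k L) x y ≡ k * evalF L x y
evalF-scaleₚ k []      x y = sym (ℤP.*-zeroʳ k)
evalF-scaleₚ k (l ∷ L) x y = begin
  k * l * x ^ length (scaleₚ k L) + y * evalF (scaleₚ k L) x y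
    ≡⟨ cong₂ (λ n z → k * l * x ^ n + y * z) (length-scaleₚ k L) (evalF-scaleₚ k L x y) ⟩
  k * l * x ^ length L + y * (k * evalF L x y)
    ≡⟨ distribute k l (x ^ length L) y (evalF L x y) ⟩
  k * (l * x ^ length L + y * evalF L x y) ∎
  where
  distribute : ∀ k l X y E → k * l * X + y * (k * E) ≡ k * (l * X + y * E)
  distribute = solve-∀

length-+ₚ : ∀ L M → length L ≤ length M → length (L +ₚ M) ≡ length M
length-+ₚ []      M       _         = refl
length-+ₚ (l ∷ L) (m ∷ M) (s≤s L≤M) = cong suc (length-+ₚ L M L≤M)

evalF-+ₚ : ∀ k L M x y → length L ℕ.+ k ≡ length M →
           evalF (L +ₚ M) x y ≡ x ^ k * evalF L x y + evalF M x y
evalF-+ₚ k []      M       x y _   = padding (x ^ k) (evalF M x y)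
  where
  padding : ∀ X E → E ≡ X * 0ℤ + E
  padding = solve-∀
evalF-+ₚ k (l ∷ L) (m ∷ M) x y eq = begin
  (l + m) * x ^ length (L +ₚ M) + y * evalF (L +ₚ M) x y
    ≡⟨ cong₂ (λ n z → (l + m) * x ^ n + y * z) (length-+ₚ L M L≤M) (evalF-+ₚ k L M x y eq′) ⟩
  (l + m) * x ^ length M + y * (x ^ k * evalF L x y + evalF M x y)
    ≡⟨ regroup l m (x ^ length L) (x ^ k) (x ^ length M) y (evalF L x y) (evalF M x y) xᴹ≡xᴸxᵏ ⟩
  x ^ k * (l * x ^ length L + y * evalF L x y) + (m * x ^ length M + y * evalF M x y) ∎
  where
  eq′ : length L ℕ.+ k ≡ length M
  eq′ = ℕP.suc-injective eq
  L≤M : length L ≤ length M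
  L≤M = ℕP.≤-trans (ℕP.m≤m+n (length L) k) (ℕP.≤-reflexive eq′)
  xᴹ≡xᴸxᵏ : x ^ length L * x ^ k ≡ x ^ length M
  xᴹ≡xᴸxᵏ = trans (sym (ℤP.^-distribˡ-+-* x (length L) k)) (cong (x ^_) eq′)
  regroup : ∀ l m P X Q y A B → P * X ≡ Q →
            (l + m) * Q + y * (X * A + B) ≡ X * (l * P + y * A) + (m * Q + y * B)
  regroup l m P X .(P * X) y A B refl = ring l m P X y A B
    where
    ring : ∀ l m P X y A B →
           (l + m) * (P * X) + y * (X * A + B) ≡ X * (l * P + y * A) + (m * (P * X) + y * B)
    ring = solve-∀

mulₚ-constant : ∀ k q Q → mulₚ (k ∷ []) (q ∷ Q) ≡ scaleₚ k (q ∷ Q)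
mulₚ-constant k q Q = cong₂ (λ h t → h ∷ t) (ℤP.+-identityʳ (k * q)) (+ₚ-identityʳ (scaleₚ k Q))
  where
  +ₚ-identityʳ : ∀ P → P +ₚ [] ≡ P
  +ₚ-identityʳ []      = refl
  +ₚ-identityʳ (_ ∷ _) = refl

length-mulₚ-linear : ∀ c e Q {n} → length Q ≡ suc n → length (mulₚ (c ∷ e ∷ []) Q) ≡ suc (suc n)
length-mulₚ-linear c e (q ∷ Q) refl rewrite mulₚ-constant e q Q =
  trans (length-+ₚ (scaleₚ c (q ∷ Q)) (0ℤ ∷ scaleₚ e (q ∷ Q)) shorter)
        (cong (λ n → suc (suc n)) (length-scaleₚ e Q))
  where
  shorter : length (scaleₚ c (q ∷ Q)) ≤ length (0ℤ ∷ scaleₚ e (q ∷ Q))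
  shorter rewrite length-scaleₚ c Q | length-scaleₚ e Q = ℕP.n≤1+n (suc (length Q))

evalF-mulₚ-linear : ∀ c e Q x y → evalF (mulₚ (c ∷ e ∷ []) Q) x y ≡ (c * x + e * y) * evalF Q x y
evalF-mulₚ-linear c e []      x y = sym (ℤP.*-zeroʳ (c * x + e * y))
evalF-mulₚ-linear c e (q ∷ Q) x y rewrite mulₚ-constant e q Q = begin
  evalF (scaleₚ c (q ∷ Q) +ₚ (0ℤ ∷ scaleₚ e (q ∷ Q))) x y
    ≡⟨ evalF-+ₚ 1 (scaleₚ c (q ∷ Q)) (0ℤ ∷ scaleₚ e (q ∷ Q)) x y lengths ⟩
  x ^ 1 * evalF (scaleₚ c (q ∷ Q)) x y + (0ℤ * x ^ length (scaleₚ e (q ∷ Q)) + y * evalF (scaleₚ e (q ∷ Q)) x y)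
    ≡⟨ cong₂ (λ u v → x ^ 1 * u + (0ℤ * x ^ length (scaleₚ e (q ∷ Q)) + y * v))
             (evalF-scaleₚ c (q ∷ Q) x y) (evalF-scaleₚ e (q ∷ Q) x y) ⟩
  x ^ 1 * (c * E) + (0ℤ * x ^ length (scaleₚ e (q ∷ Q)) + y * (e * E))
    ≡⟨ ring x c e y E (x ^ length (scaleₚ e (q ∷ Q))) ⟩
  (c * x + e * y) * E ∎
  where
  E : ℤ
  E = evalF (q ∷ Q) x y
  lengths : length (scaleₚ c (q ∷ Q)) ℕ.+ 1 ≡ length (0ℤ ∷ scaleₚ e (q ∷ Q))
  lengths rewrite length-scaleₚ c Q | length-scaleₚ e Q = cong suc (ℕP.+-comm (length Q) 1)
  ring : ∀ x c e y E Z → x * 1ℤ * (c * E) + (0ℤ * Z + y * (e * E)) ≡ (c * x + e * y) * E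
  ring = solve-∀

length-powₚ-linear : ∀ a b n → length (powₚ (a ∷ b ∷ []) n) ≡ suc n
length-powₚ-linear a b zero    = refl
length-powₚ-linear a b (suc n) = length-mulₚ-linear a b (powₚ (a ∷ b ∷ []) n) (length-powₚ-linear a b n)

evalF-powₚ-linear : ∀ a b n x y → evalF (powₚ (a ∷ b ∷ []) n) x y ≡ (a * x + b * y) ^ n
evalF-powₚ-linear a b zero    x y = cong (λ z → 1ℤ * 1ℤ + z) (ℤP.*-zeroʳ y)
evalF-powₚ-linear a b (suc n) x y =
  trans (evalF-mulₚ-linear a b (powₚ (a ∷ b ∷ []) n) x y)
        (cong ((a * x + b * y) *_) (evalF-powₚ-linear a b n x y))

infixl 9 _∘ₘ_
_∘ₘ_ : (ℤ → ℤ → ℤ) → Mat → ℤ → ℤ → ℤ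
(f ∘ₘ γ) x y = f (a γ * x + b γ * y) (c γ * x + e γ * y)

length-∘F : ∀ L γ → length (L ∘F γ) ≡ length L
length-∘F []              γ = refl
length-∘F (l ∷ [])        γ = refl
length-∘F (l ∷ L@(_ ∷ _)) γ = step (length-∘F L γ)
  where
  P R : List ℤ
  P = powₚ (a γ ∷ b γ ∷ []) (length L)
  R = mulₚ (c γ ∷ e γ ∷ []) (L ∘F γ)
  lengthP : length (scaleₚ l P) ≡ suc (length L)
  lengthP = trans (length-scaleₚ l P) (length-powₚ-linear (a γ) (b γ) (length L))
  step : length (L ∘F γ) ≡ length L → length (scaleₚ l P +ₚ R) ≡ suc (length L)
  step ih = trans (length-+ₚ (scaleₚ l P) R (ℕP.≤-reflexive (trans lengthP (sym lengthR)))) lengthR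
    where
    lengthR : length R ≡ suc (length L)
    lengthR = length-mulₚ-linear (c γ) (e γ) (L ∘F γ) ih

evalF-∘F : ∀ L γ x y → evalF (L ∘F γ) x y ≡ (evalF L ∘ₘ γ) x y
evalF-∘F []              γ x y = refl
evalF-∘F (l ∷ [])        γ x y = constant l y (c γ * x + e γ * y)
  where
  constant : ∀ l y v → l * 1ℤ * 1ℤ + y * 0ℤ ≡ l * 1ℤ + v * 0ℤ
  constant = solve-∀
evalF-∘F (l ∷ L@(_ ∷ _)) γ x y = begin
  evalF (scaleₚ l P +ₚ R) x y
    ≡⟨ evalF-+ₚ 0 (scaleₚ l P) R x y same-length ⟩
  x ^ 0 * evalF (scaleₚ l P) x y + evalF R x y
    ≡⟨ cong₂ (λ s r → 1ℤ * s + r) (evalF-scaleₚ l P x y) (evalF-mulₚ-linear (c γ) (e γ) (L ∘F γ) x y) ⟩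
  1ℤ * (l * evalF P x y) + v * evalF (L ∘F γ) x y
    ≡⟨ cong₂ (λ p q → 1ℤ * (l * p) + v * q) (evalF-powₚ-linear (a γ) (b γ) (length L) x y) (evalF-∘F L γ x y) ⟩
  1ℤ * (l * u ^ length L) + v * evalF L u v
    ≡⟨ cong (_+ v * evalF L u v) (ℤP.*-identityˡ (l * u ^ length L)) ⟩
  l * u ^ length L + v * evalF L u v ∎
  where
  u v : ℤ
  u = a γ * x + b γ * y
  v = c γ * x + e γ * y
  P R : List ℤ
  P = powₚ (a γ ∷ b γ ∷ []) (length L)
  R = mulₚ (c γ ∷ e γ ∷ []) (L ∘F γ)
  same-length : length (scaleₚ l P) ℕ.+ 0 ≡ length R
  same-length = begin
    length (scaleₚ l P) ℕ.+ 0 ≡⟨ ℕP.+-identityʳ _ ⟩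
    length (scaleₚ l P)       ≡⟨ length-scaleₚ l P ⟩
    length P                  ≡⟨ length-powₚ-linear (a γ) (b γ) (length L) ⟩
    suc (length L)            ≡⟨ length-mulₚ-linear (c γ) (e γ) (L ∘F γ) (length-∘F L γ) ⟨
    length R                  ∎

evalF-∘F-· : ∀ L γ δ x y → evalF ((L ∘F γ) ∘F δ) x y ≡ evalF (L ∘F (γ · δ)) x y
evalF-∘F-· L γ@(mat a b c e) δ@(mat a′ b′ c′ e′) x y = begin
  evalF ((L ∘F γ) ∘F δ) x y           ≡⟨ evalF-∘F (L ∘F γ) δ x y ⟩
  (evalF (L ∘F γ) ∘ₘ δ) x y           ≡⟨ evalF-∘F L γ _ _ ⟩
  ((evalF L ∘ₘ γ) ∘ₘ δ) x y           ≡⟨ cong₂ (evalF L) (assoc a b a′ b′ c′ e′ x y) (assoc c e a′ b′ c′ e′ x y) ⟩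
  (evalF L ∘ₘ (γ · δ)) x y            ≡⟨ evalF-∘F L (γ · δ) x y ⟨
  evalF (L ∘F (γ · δ)) x y            ∎
  where
  assoc : ∀ a b a′ b′ c′ e′ x y →
          a * (a′ * x + b′ * y) + b * (c′ * x + e′ * y) ≡ (a * a′ + b * c′) * x + (a * b′ + b * e′) * y
  assoc = solve-∀

^-distribʳ-* : ∀ i j n → (i * j) ^ n ≡ i ^ n * j ^ n
^-distribʳ-* i j zero    = refl
^-distribʳ-* i j (suc n) =
  trans (cong ((i * j) *_) (^-distribʳ-* i j n)) (interchange i j (i ^ n) (j ^ n))
  where
  interchange : ∀ i j I J → i * j * (I * J) ≡ i * I * (j * J)
  interchange = solve-∀

evalF-homogeneous : ∀ L k x y → evalF L (k * x) (k * y) ≡ k ^ ℕ.pred (length L) * evalF L x y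
evalF-homogeneous []               k x y = refl
evalF-homogeneous (l ∷ [])         k x y = ring l k y
  where
  ring : ∀ l k y → l * 1ℤ + k * y * 0ℤ ≡ 1ℤ * (l * 1ℤ + y * 0ℤ)
  ring = solve-∀
evalF-homogeneous (l ∷ L@(_ ∷ L′)) k x y = begin
  l * (k * x) ^ length L + k * y * evalF L (k * x) (k * y)
    ≡⟨ cong₂ (λ p q → l * p + k * y * q) (^-distribʳ-* k x (length L)) (evalF-homogeneous L k x y) ⟩
  l * (k * k ^ length L′ * x ^ length L) + k * y * (k ^ length L′ * evalF L x y)
    ≡⟨ ring l k (k ^ length L′) (x ^ length L) y (evalF L x y) ⟩
  k * k ^ length L′ * (l * x ^ length L + y * evalF L x y) ∎
  where
  ring : ∀ l k K X y E → l * (k * K * X) + k * y * (K * E) ≡ k * K * (l * X + y * E)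
  ring = solve-∀

evalF-∘F-I₂ : ∀ L x y → evalF (L ∘F I₂) x y ≡ evalF L x y
evalF-∘F-I₂ L x y = trans (evalF-∘F L I₂ x y) (cong₂ (evalF L) (identity x y) (identity′ x y))
  where
  identity : ∀ x y → 1ℤ * x + 0ℤ * y ≡ x
  identity = solve-∀
  identity′ : ∀ x y → 0ℤ * x + 1ℤ * y ≡ y
  identity′ = solve-∀

n∣m∧m<n⇒m≡0 : ∀ {m n} → n ℕD.∣ m → m ℕ.< n → m ≡ 0
n∣m∧m<n⇒m≡0 {zero}  _   _   = refl
n∣m∧m<n⇒m≡0 {suc m} n∣m m<n = contradiction n∣m (ℕD.>⇒∤ m<n)

+n∣i∧∣i∣<n⇒i≡0 : ∀ {n i} → + n ∣ i → ∣ i ∣ ℕ.< n → i ≡ 0ℤ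
+n∣i∧∣i∣<n⇒i≡0 n∣i ∣i∣<n = ℤP.∣i∣≡0⇒i≡0 (n∣m∧m<n⇒m≡0 (∣⇒∣ᵤ n∣i) ∣i∣<n)

evalF-at-1 : ∀ l L t → evalF (l ∷ L) 1ℤ t ≡ l + t * evalF L 1ℤ t
evalF-at-1 l L t = cong (_+ t * evalF L 1ℤ t) (trans (cong (l *_) (ℤP.^-zeroˡ (length L))) (ℤP.*-identityʳ l))

-- The leading coefficients agree because  l - m = t * (B(t) - A(t))  is divisible by t = 1 + ∣l - m∣.
evalF-1-injective : ∀ L M → length L ≡ length M →
                    (∀ t → evalF L 1ℤ (+ suc t) ≡ evalF M 1ℤ (+ suc t)) → L ≡ M
evalF-1-injective []      []      _  _ = refl
evalF-1-injective (l ∷ L) (m ∷ M) eq H = cong₂ _∷_ l≡m (evalF-1-injective L M (ℕP.suc-injective eq) tails)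
  where
  A B : ℕ → ℤ
  A t = evalF L 1ℤ (+ suc t)
  B t = evalF M 1ℤ (+ suc t)
  heads : ∀ t → l + + suc t * A t ≡ m + + suc t * B t
  heads t = trans (sym (evalF-at-1 l L (+ suc t))) (trans (H t) (evalF-at-1 m M (+ suc t)))
  difference : ∀ t → l - m ≡ (B t - A t) * + suc t
  difference t = ring l m (+ suc t) (A t) (B t) (heads t)
    where
    ring : ∀ l m T A B → l + T * A ≡ m + T * B → l - m ≡ (B - A) * T
    ring l m T A B h = begin
      l - m                     ≡⟨ shift l m (T * A) ⟩
      (l + T * A) - (m + T * A) ≡⟨ cong (_- (m + T * A)) h ⟩
      (m + T * B) - (m + T * A) ≡⟨ factor m T A B ⟩
      (B - A) * T               ∎
      where
      shift : ∀ l m X → l - m ≡ (l + X) - (m + X)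
      shift = solve-∀
      factor : ∀ m T A B → (m + T * B) - (m + T * A) ≡ (B - A) * T
      factor = solve-∀
  t₀ : ℕ
  t₀ = ∣ l - m ∣
  l≡m : l ≡ m
  l≡m = ℤP.i-j≡0⇒i≡j l m (+n∣i∧∣i∣<n⇒i≡0 (divides (B t₀ - A t₀) (difference t₀)) ℕP.≤-refl)
  tails : ∀ t → A t ≡ B t
  tails t = ℤP.*-cancelˡ-≡ (+ suc t) (A t) (B t) (+-cancelˡ l _ _ (trans (heads t) (cong (_+ + suc t * B t) (sym l≡m))))

evalF-injective : ∀ L M → length L ≡ length M → (∀ x y → evalF L x y ≡ evalF M x y) → L ≡ M
evalF-injective L M eq H = evalF-1-injective L M eq (λ t → H 1ℤ (+ suc t))

evalF-replicate-0 : ∀ n x y → evalF (replicate n 0ℤ) x y ≡ 0ℤ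
evalF-replicate-0 zero    x y = refl
evalF-replicate-0 (suc n) x y =
  trans (cong (λ z → 0ℤ * x ^ length (replicate n 0ℤ) + y * z) (evalF-replicate-0 n x y))
        (vanish (x ^ length (replicate n 0ℤ)) y)
  where
  vanish : ∀ X y → 0ℤ * X + y * 0ℤ ≡ 0ℤ
  vanish = solve-∀

evalF≡0⇒replicate-0 : ∀ L → (∀ x y → evalF L x y ≡ 0ℤ) → L ≡ replicate (length L) 0ℤ
evalF≡0⇒replicate-0 L H = evalF-injective L (replicate (length L) 0ℤ) (sym (ListP.length-replicate (length L)))
  (λ x y → trans (H x y) (sym (evalF-replicate-0 (length L) x y)))

coeff-replicate-0 : ∀ {d} (F : Vec ℤ (suc d)) → toList F ≡ replicate (suc d) 0ℤ → ∀ i → coeff F i ≡ 0ℤ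
coeff-replicate-0 (x ∷ [])     F≡0 zero    = proj₁ (ListP.∷-injective F≡0)
coeff-replicate-0 (x ∷ [])     F≡0 (suc i) = refl
coeff-replicate-0 (x ∷ y ∷ F) F≡0 zero    = proj₁ (ListP.∷-injective F≡0)
coeff-replicate-0 (x ∷ y ∷ F) F≡0 (suc i) = coeff-replicate-0 (y ∷ F) (proj₂ (ListP.∷-injective F≡0)) i

sumFin-zero : ∀ n (f : Fin n → ℤ) → (∀ j → f j ≡ 0ℤ) → sumFin n f ≡ 0ℤ
sumFin-zero zero    f f≡0 = refl
sumFin-zero (suc n) f f≡0 = cong₂ _+_ (f≡0 fzero) (sumFin-zero n (λ j → f (fsuc j)) (λ j → f≡0 (fsuc j)))

det-zero-row : ∀ n (M : Fin (suc n) → Fin (suc n) → ℤ) → (∀ j → M fzero j ≡ 0ℤ) → det (suc n) M ≡ 0ℤ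
det-zero-row n M row≡0 = sumFin-zero (suc n) _ λ j →
  trans (cong (λ z → sgn (toℕ j) * z * minor j) (row≡0 j)) (annihilate (sgn (toℕ j)) (minor j))
  where
  minor : Fin (suc n) → ℤ
  minor j = det n (λ r s → M (fsuc r) (punchIn j s))
  annihilate : ∀ σ D → σ * 0ℤ * D ≡ 0ℤ
  annihilate = solve-∀

-- Degree ≥ 2 makes the Sylvester matrix nonempty (for degree 1 its determinant is 1);
-- its first row holds coefficients of F_X.
disc-zero : ∀ {d} (F : Vec ℤ (suc (suc (suc d)))) → (∀ i → coeff F i ≡ 0ℤ) → disc F ≡ 0ℤ
disc-zero {d} F coeff≡0 = begin
  (σ * res (suc d) (suc d) (coeffFX F) (coeffFY F)) /ℕ N ≡⟨ cong (λ r → (σ * r) /ℕ N) res≡0 ⟩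
  (σ * 0ℤ) /ℕ N                                         ≡⟨ cong (_/ℕ N) (ℤP.*-zeroʳ σ) ⟩
  0ℤ /ℕ N                                               ≡⟨ cong +_ (ℕDM.0/n≡0 N) ⟩
  0ℤ                                                    ∎
  where
  D N : ℕ
  D = suc (suc d)
  N = D ℕ.^ (D ℕ.∸ 2)
  instance
    N≢0 : ℕ.NonZero N
    N≢0 = nz D
  σ : ℤ
  σ = sgn ((D ℕ.* (D ℕ.∸ 1)) ℕ./ 2)
  res≡0 : res (suc d) (suc d) (coeffFX F) (coeffFY F) ≡ 0ℤ
  res≡0 = det-zero-row _ (sylvester (suc d) (suc d) (coeffFX F) (coeffFY F))
    (λ j → trans (cong (+ (D ℕ.∸ toℕ j) *_) (coeff≡0 (toℕ j))) (ℤP.*-zeroʳ (+ (D ℕ.∸ toℕ j))))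

mat-cong : ∀ {a b c e a′ b′ c′ e′} → a ≡ a′ → b ≡ b′ → c ≡ c′ → e ≡ e′ → mat a b c e ≡ mat a′ b′ c′ e′
mat-cong refl refl refl refl = refl

trace : Mat → ℤ
trace (mat a b c e) = a + e

adj : Mat → Mat
adj (mat a b c e) = mat e (- b) (- c) a

·-adj : ∀ γ → det₂ γ ≡ 1ℤ → γ · adj γ ≡ I₂
·-adj (mat a b c e) det≡1 = mat-cong (trans (diagonal a b c e) det≡1) (off-diagonal a b) (off-diagonal′ c e)
                                     (trans (diagonal′ a b c e) det≡1)
  where
  diagonal : ∀ a b c e → a * e + b * - c ≡ a * e - b * c
  diagonal = solve-∀
  off-diagonal : ∀ a b → a * - b + b * a ≡ 0ℤ
  off-diagonal = solve-∀
  off-diagonal′ : ∀ c e → c * e + e * - c ≡ 0ℤ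
  off-diagonal′ = solve-∀
  diagonal′ : ∀ a b c e → c * - b + e * a ≡ a * e - b * c
  diagonal′ = solve-∀

InGL2⇒det²≡1 : ∀ {γ} → InGL2 γ → det₂ γ * det₂ γ ≡ 1ℤ
InGL2⇒det²≡1 (inj₁ det≡1)  = cong₂ _*_ det≡1 det≡1
InGL2⇒det²≡1 (inj₂ det≡-1) = cong₂ _*_ det≡-1 det≡-1

-- Over ℤ, γ ∈ GL(2,ℤ) has inverse det γ · adj γ.
∘ₘ-GL-inverse : ∀ f γ → InGL2 γ → ∀ u v →
                (f ∘ₘ γ) (det₂ γ * (e γ * u + - b γ * v)) (det₂ γ * (- c γ * u + a γ * v)) ≡ f u v
∘ₘ-GL-inverse f (mat p q r s) γ∈GL u v = cong₂ f
  (trans (first p q r s u v) (scale-by-1 u)) (trans (second p q r s u v) (scale-by-1 v))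
  where
  scale-by-1 : ∀ w → (p * s - q * r) * (p * s - q * r) * w ≡ w
  scale-by-1 w = trans (cong (_* w) (InGL2⇒det²≡1 {mat p q r s} γ∈GL)) (ℤP.*-identityˡ w)
  first : ∀ p q r s u v → p * ((p * s - q * r) * (s * u + - q * v)) + q * ((p * s - q * r) * (- r * u + p * v))
                        ≡ (p * s - q * r) * (p * s - q * r) * u
  first = solve-∀
  second : ∀ p q r s u v → r * ((p * s - q * r) * (s * u + - q * v)) + s * ((p * s - q * r) * (- r * u + p * v))
                         ≡ (p * s - q * r) * (p * s - q * r) * v
  second = solve-∀

-- Cayley–Hamilton: γ² = t γ - D I, hence γ³ = (t² - D) γ - t D I.
cube-cayley-hamilton : ∀ a b c e → let t = a + e ; D = a * e - b * c ; K = t * t - D in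
  mat a b c e · (mat a b c e · mat a b c e) ≡ mat (K * a - t * D) (K * b) (K * c) (K * e - t * D)
cube-cayley-hamilton a b c e = mat-cong (entryₐ a b c e) (entryᵦ a b c e) (entryᵪ a b c e) (entryₑ a b c e)
  where
  entryₐ : ∀ a b c e → a * (a * a + b * c) + b * (c * a + e * c)
                     ≡ ((a + e) * (a + e) - (a * e - b * c)) * a - (a + e) * (a * e - b * c)
  entryₐ = solve-∀
  entryᵦ : ∀ a b c e → a * (a * b + b * e) + b * (c * b + e * e) ≡ ((a + e) * (a + e) - (a * e - b * c)) * b
  entryᵦ = solve-∀
  entryᵪ : ∀ a b c e → c * (a * a + b * c) + e * (c * a + e * c) ≡ ((a + e) * (a + e) - (a * e - b * c)) * c
  entryᵪ = solve-∀
  entryₑ : ∀ a b c e → c * (a * b + b * e) + e * (c * b + e * e)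
                     ≡ ((a + e) * (a + e) - (a * e - b * c)) * e - (a + e) * (a * e - b * c)
  entryₑ = solve-∀

i³≡1⇒i≡1 : ∀ i → i * (i * i) ≡ 1ℤ → i ≡ 1ℤ
i³≡1⇒i≡1 i i³≡1 = sign-case i (ℕP.m*n≡1⇒m≡1 ∣ i ∣ _ ∣i∣³≡1) i³≡1
  where
  ∣i∣³≡1 : ∣ i ∣ ℕ.* (∣ i ∣ ℕ.* ∣ i ∣) ≡ 1
  ∣i∣³≡1 = begin
    ∣ i ∣ ℕ.* (∣ i ∣ ℕ.* ∣ i ∣) ≡⟨ cong (∣ i ∣ ℕ.*_) (ℤP.abs-* i i) ⟨
    ∣ i ∣ ℕ.* ∣ i * i ∣         ≡⟨ ℤP.abs-* i (i * i) ⟨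
    ∣ i * (i * i) ∣             ≡⟨ cong ∣_∣ i³≡1 ⟩
    1                           ∎
  sign-case : ∀ i → ∣ i ∣ ≡ 1 → i * (i * i) ≡ 1ℤ → i ≡ 1ℤ
  sign-case (+ _)    ∣i∣≡1 _  = cong +_ ∣i∣≡1
  sign-case -[1+ 0 ] _     ()

scalar-order3 : ∀ a → mat a 0ℤ 0ℤ a · (mat a 0ℤ 0ℤ a · mat a 0ℤ 0ℤ a) ≡ I₂ → mat a 0ℤ 0ℤ a ≡ I₂
scalar-order3 a γ³≡I = mat-cong a≡1 refl refl a≡1
  where
  a≡1 : a ≡ 1ℤ
  a≡1 = i³≡1⇒i≡1 a (trans (ring a) (cong Mat.a γ³≡I))
    where
    ring : ∀ a → a * (a * a) ≡ a * (a * a + 0ℤ * 0ℤ) + 0ℤ * (0ℤ * a + a * 0ℤ)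
    ring = solve-∀

module CubeRoot (a b c e : ℤ) (γ³≡I : mat a b c e · (mat a b c e · mat a b c e) ≡ I₂) where

  t D K : ℤ
  t = a + e
  D = a * e - b * c
  K = t * t - D

  entries : mat (K * a - t * D) (K * b) (K * c) (K * e - t * D) ≡ I₂
  entries = trans (sym (cube-cayley-hamilton a b c e)) γ³≡I

  K≢0⇒γ≡I : K ≢ 0ℤ → mat a b c e ≡ I₂
  K≢0⇒γ≡I K≢0 = trans γ≡a·I (scalar-order3 a (subst (λ γ → γ · (γ · γ) ≡ I₂) γ≡a·I γ³≡I))
    where
    instance
      K-nonZero : ℤ.NonZero K
      K-nonZero = ℤ.≢-nonZero K≢0
    K*-injective : ∀ {x y} → K * x ≡ K * y → x ≡ y
    K*-injective {x} {y} = ℤP.*-cancelˡ-≡ K x y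
    γ≡a·I : mat a b c e ≡ mat a 0ℤ 0ℤ a
    γ≡a·I = mat-cong refl
      (K*-injective (trans (cong Mat.b entries) (sym (ℤP.*-zeroʳ K))))
      (K*-injective (trans (cong Mat.c entries) (sym (ℤP.*-zeroʳ K))))
      (K*-injective (+-cancelʳ (- (t * D)) (K * e) (K * a) (trans (cong Mat.e entries) (sym (cong Mat.a entries)))))

  K≡0⇒trace≡-1∧det≡1 : InGL2 (mat a b c e) → K ≡ 0ℤ → t ≡ -1ℤ × D ≡ 1ℤ
  K≡0⇒trace≡-1∧det≡1 γ∈GL K≡0 = by-det γ∈GL
    where
    tD≡-1 : t * D ≡ -1ℤ
    tD≡-1 = trans (negate (t * D) a) (cong -_ (trans (cong (λ k → k * a - t * D) (sym K≡0)) (cong Mat.a entries)))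
      where
      negate : ∀ X a → X ≡ - (0ℤ * a - X)
      negate = solve-∀
    by-det : (D ≡ 1ℤ) ⊎ (D ≡ -1ℤ) → t ≡ -1ℤ × D ≡ 1ℤ
    by-det (inj₁ D≡1)  = trans (sym (ℤP.*-identityʳ t)) (trans (cong (t *_) (sym D≡1)) tD≡-1) , D≡1
    by-det (inj₂ D≡-1) = contradiction (trans (sym (cong₂ (λ t D → t * t - D) t≡1 D≡-1)) K≡0) λ ()
      where
      t≡1 : t ≡ 1ℤ
      t≡1 = trans (negate t) (trans (cong (λ d → - (t * d)) (sym D≡-1)) (cong -_ tD≡-1))
        where
        negate : ∀ t → t ≡ - (t * -1ℤ)
        negate = solve-∀

  trace≡-1∧det≡1 : InGL2 (mat a b c e) → mat a b c e ≢ I₂ → t ≡ -1ℤ × D ≡ 1ℤ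
  trace≡-1∧det≡1 γ∈GL γ≢I with K ℤ.≟ 0ℤ
  ... | yes K≡0 = K≡0⇒trace≡-1∧det≡1 γ∈GL K≡0
  ... | no  K≢0 = contradiction (K≢0⇒γ≡I K≢0) γ≢I

order3⇒trace≡-1∧det≡1 : ∀ {γ} → InGL2 γ → HasOrder3 γ → trace γ ≡ -1ℤ × det₂ γ ≡ 1ℤ
order3⇒trace≡-1∧det≡1 {mat a b c e} γ∈GL (γ³≡I , γ≢I , _) = CubeRoot.trace≡-1∧det≡1 a b c e γ³≡I γ∈GL γ≢I

evalF-automorphism : ∀ L σ → L ∘F σ ≡ L → ∀ x y → (evalF L ∘ₘ σ) x y ≡ evalF L x y
evalF-automorphism L σ L∘σ≡L x y = trans (sym (evalF-∘F L σ x y)) (cong (λ M → evalF M x y) L∘σ≡L)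

automorphism-adj : ∀ L γ → det₂ γ ≡ 1ℤ → L ∘F γ ≡ L → L ∘F adj γ ≡ L
automorphism-adj L γ det≡1 L∘γ≡L = evalF-injective (L ∘F adj γ) L (length-∘F L (adj γ)) λ x y → begin
  evalF (L ∘F adj γ) x y         ≡⟨ cong (λ M → evalF (M ∘F adj γ) x y) L∘γ≡L ⟨
  evalF ((L ∘F γ) ∘F adj γ) x y  ≡⟨ evalF-∘F-· L γ (adj γ) x y ⟩
  evalF (L ∘F (γ · adj γ)) x y   ≡⟨ cong (λ δ → evalF (L ∘F δ) x y) (·-adj γ det≡1) ⟩
  evalF (L ∘F I₂) x y            ≡⟨ evalF-∘F-I₂ L x y ⟩
  evalF L x y                    ∎

values-∘F : ∀ L γ {n} → InValues (L ∘F γ) n → InValues L n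
values-∘F L γ (x , y , eq) = _ , _ , trans (sym (evalF-∘F L γ x y)) eq

sameValues-∘F : ∀ L γ → (∀ u v → ∃[ x ] ∃[ y ] evalF (L ∘F γ) x y ≡ evalF L u v) → SameValueSet L (L ∘F γ)
sameValues-∘F L γ attains n = (λ (u , v , eq) → let (x , y , eq′) = attains u v in x , y , trans eq′ eq)
                            , values-∘F L γ

diag₂₁ diag₁₂ : Mat
diag₂₁ = mat (+ 2) 0ℤ 0ℤ 1ℤ
diag₁₂ = mat 1ℤ 0ℤ 0ℤ (+ 2)

evalF-∘F-diag₂₁ : ∀ L x y → evalF (L ∘F diag₂₁) x y ≡ evalF L (+ 2 * x) y
evalF-∘F-diag₂₁ L x y = trans (evalF-∘F L diag₂₁ x y) (cong₂ (evalF L) (first x y) (second x y))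
  where
  first : ∀ x y → + 2 * x + 0ℤ * y ≡ + 2 * x
  first = solve-∀
  second : ∀ x y → 0ℤ * x + 1ℤ * y ≡ y
  second = solve-∀

evalF-∘F-diag₁₂ : ∀ L x y → evalF (L ∘F diag₁₂) x y ≡ evalF L x (+ 2 * y)
evalF-∘F-diag₁₂ L x y = trans (evalF-∘F L diag₁₂ x y) (cong₂ (evalF L) (first x y) (second x y))
  where
  first : ∀ x y → 1ℤ * x + 0ℤ * y ≡ x
  first = solve-∀
  second : ∀ x y → 0ℤ * x + + 2 * y ≡ + 2 * y
  second = solve-∀

·-diag₁₂ : ∀ a′ b c e → mat (+ 2 * a′) b c e · diag₁₂ ≡ diag₂₁ · mat a′ b c (+ 2 * e)
·-diag₁₂ a′ b c e = mat-cong (ringₐ a′ b c) (ringᵦ a′ b e) (ringᵪ a′ c e) (ringₑ b c e)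
  where
  ringₐ : ∀ a′ b c → + 2 * a′ * 1ℤ + b * 0ℤ ≡ + 2 * a′ + 0ℤ * c
  ringₐ = solve-∀
  ringᵦ : ∀ a′ b e → + 2 * a′ * 0ℤ + b * + 2 ≡ + 2 * b + 0ℤ * (+ 2 * e)
  ringᵦ = solve-∀
  ringᵪ : ∀ a′ c e → c * 1ℤ + e * 0ℤ ≡ 0ℤ * a′ + 1ℤ * c
  ringᵪ = solve-∀
  ringₑ : ∀ b c e → c * 0ℤ + e * + 2 ≡ 0ℤ * b + 1ℤ * (+ 2 * e)
  ringₑ = solve-∀

diag₁₂≅diag₂₁ : ∀ L {a b c e} a′ → a ≡ + 2 * a′ → a * e - b * c ≡ 1ℤ → L ∘F mat a b c e ≡ L →
               ∃[ γ ] InGL2 γ × (L ∘F diag₁₂ ≡ (L ∘F diag₂₁) ∘F γ)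
diag₁₂≅diag₂₁ L {b = b} {c} {e} a′ refl detσ≡1 L∘σ≡L = γ , inj₁ detγ≡1 , evalF-injective _ _ same-length λ x y → begin
  evalF (L ∘F diag₁₂) x y              ≡⟨ cong (λ M → evalF (M ∘F diag₁₂) x y) L∘σ≡L ⟨
  evalF ((L ∘F σ) ∘F diag₁₂) x y       ≡⟨ evalF-∘F-· L σ diag₁₂ x y ⟩
  evalF (L ∘F (σ · diag₁₂)) x y        ≡⟨ cong (λ δ → evalF (L ∘F δ) x y) (·-diag₁₂ a′ b c e) ⟩
  evalF (L ∘F (diag₂₁ · γ)) x y        ≡⟨ evalF-∘F-· L diag₂₁ γ x y ⟨
  evalF ((L ∘F diag₂₁) ∘F γ) x y       ∎
  where
  σ γ : Mat
  σ = mat (+ 2 * a′) b c e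
  γ = mat a′ b c (+ 2 * e)
  detγ≡1 : det₂ γ ≡ 1ℤ
  detγ≡1 = trans (move-2 a′ b c e) detσ≡1
    where
    move-2 : ∀ a′ b c e → a′ * (+ 2 * e) - b * c ≡ + 2 * a′ * e - b * c
    move-2 = solve-∀
  same-length : length (L ∘F diag₁₂) ≡ length ((L ∘F diag₂₁) ∘F γ)
  same-length = trans (length-∘F L diag₁₂) (sym (trans (length-∘F (L ∘F diag₂₁) γ) (length-∘F L diag₂₁)))

Even : ℤ → Set
Even i = + 2 ∣ i

parity : ∀ i → Even i ⊎ Even (1ℤ + i)
parity i with i ℤ.%ℕ 2 | i ℤ./ℕ 2 | ℤDM.a≡a%ℕn+[a/ℕn]*n i 2 | ℤDM.n%ℕd<d i 2
... | 0 | q | i≡q*2   | _ = inj₁ (divides q (trans i≡q*2 (ℤP.+-identityˡ (q * + 2))))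
... | 1 | q | i≡1+q*2 | _ = inj₂ (divides (q + 1ℤ) (trans (cong (ℤ._+_ 1ℤ) i≡1+q*2) (ring q)))
  where
  ring : ∀ q → 1ℤ + (1ℤ + q * + 2) ≡ (q + 1ℤ) * + 2
  ring = solve-∀
... | suc (suc _) | _ | _ | s≤s (s≤s ())

n<2^n : ∀ n → n ℕ.< 2 ℕ.^ n
n<2^n zero    = ℕP.0<1+n
n<2^n (suc n) = ℕP.+-mono-≤ (ℕP.m^n>0 2 n) (ℕP.≤-trans (n<2^n n) (ℕP.m≤m+n (2 ℕ.^ n) 0))

module Descent (f : ℤ → ℤ → ℤ) (m : ℕ)
               (homogeneous : ∀ x y → f (+ 2 * x) (+ 2 * y) ≡ (+ 2) ^ suc m * f x y)
               (halving : ∀ u v → ∃[ x ] ∃[ y ] f u v ≡ f (+ 2 * x) (+ 2 * y)) where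

  2ⁿ∣f : ∀ n u v → + (2 ℕ.^ n) ∣ f u v
  2ⁿ∣f zero    u v = divides (f u v) (sym (ℤP.*-identityʳ (f u v)))
  2ⁿ∣f (suc n) u v with halving u v
  ... | x , y , f≡ with 2ⁿ∣f n x y
  ... | divides q fxy≡q*2ⁿ = divides ((+ 2) ^ m * q) (begin
    f u v                                 ≡⟨ f≡ ⟩
    f (+ 2 * x) (+ 2 * y)                 ≡⟨ homogeneous x y ⟩
    + 2 * (+ 2) ^ m * f x y               ≡⟨ cong (λ z → + 2 * (+ 2) ^ m * z) fxy≡q*2ⁿ ⟩
    + 2 * (+ 2) ^ m * (q * + (2 ℕ.^ n))   ≡⟨ ring (+ 2) ((+ 2) ^ m) q (+ (2 ℕ.^ n)) ⟩
    (+ 2) ^ m * q * (+ 2 * + (2 ℕ.^ n))   ≡⟨ cong ((+ 2) ^ m * q *_) (ℤP.pos-* 2 (2 ℕ.^ n)) ⟨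
    (+ 2) ^ m * q * + (2 ℕ.^ suc n)       ∎)
    where
    ring : ∀ t T q N → t * T * (q * N) ≡ T * q * (t * N)
    ring = solve-∀

  vanishes : ∀ u v → f u v ≡ 0ℤ
  vanishes u v = +n∣i∧∣i∣<n⇒i≡0 (2ⁿ∣f ∣ f u v ∣ u v) (n<2^n ∣ f u v ∣)

module Order3Automorphism (L : List ℤ) {a b c e : ℤ} (trace≡-1 : a + e ≡ -1ℤ) (det≡1 : a * e - b * c ≡ 1ℤ)
                          (L∘ρ≡L : L ∘F mat a b c e ≡ L) where

  ρ : Mat
  ρ = mat a b c e

  L∘adjρ≡L : L ∘F adj ρ ≡ L
  L∘adjρ≡L = automorphism-adj L ρ det≡1 L∘ρ≡L

  -- adj ρ = (tr ρ) I - ρ = - I - ρ, so  ℓ(adj ρ w) = - ℓ(w) - ℓ(ρ w).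
  even-in-orbit : ∀ α β u v → ∃[ u′ ] ∃[ v′ ] evalF L u′ v′ ≡ evalF L u v × Even (α * u′ + β * v′)
  even-in-orbit α β u v with parity (α * u + β * v) | parity (α * (a * u + b * v) + β * (c * u + e * v))
  ... | inj₁ even | _         = u , v , refl , even
  ... | inj₂ _    | inj₁ even = _ , _ , evalF-automorphism L ρ L∘ρ≡L u v , even
  ... | inj₂ odd  | inj₂ odd′ = _ , _ , evalF-automorphism L (adj ρ) L∘adjρ≡L u v , subst Even (sym orbit-sum) sum-even
    where
    ℓ ℓρ : ℤ
    ℓ  = α * u + β * v
    ℓρ = α * (a * u + b * v) + β * (c * u + e * v)
    orbit-sum : α * (e * u + - b * v) + β * (- c * u + a * v) ≡ (1ℤ + (a + e)) * ℓ + + 2 - ((1ℤ + ℓ) + (1ℤ + ℓρ))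
    orbit-sum = ring α β a b c e u v
      where
      ring : ∀ α β a b c e u v → α * (e * u + - b * v) + β * (- c * u + a * v)
           ≡ (1ℤ + (a + e)) * (α * u + β * v) + + 2 - ((1ℤ + (α * u + β * v)) + (1ℤ + (α * (a * u + b * v) + β * (c * u + e * v))))
      ring = solve-∀
    sum-even : Even ((1ℤ + (a + e)) * ℓ + + 2 - ((1ℤ + ℓ) + (1ℤ + ℓρ)))
    sum-even = ∣m∣n⇒∣m-n (∣m∣n⇒∣m+n (∣m⇒∣m*n ℓ (divides 0ℤ (cong (ℤ._+_ 1ℤ) trace≡-1))) ∣-refl) (∣m∣n⇒∣m+n odd odd′)

  diag₂₁-attains : ∀ u v → ∃[ x ] ∃[ y ] evalF (L ∘F diag₂₁) x y ≡ evalF L u v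
  diag₂₁-attains u v with even-in-orbit 1ℤ 0ℤ u v
  ... | u′ , v′ , same , divides k u′≡k*2 = k , v′ , (begin
    evalF (L ∘F diag₂₁) k v′ ≡⟨ evalF-∘F-diag₂₁ L k v′ ⟩
    evalF L (+ 2 * k) v′     ≡⟨ cong (λ x → evalF L x v′) 2k≡u′ ⟩
    evalF L u′ v′            ≡⟨ same ⟩
    evalF L u v              ∎)
    where
    2k≡u′ : + 2 * k ≡ u′
    2k≡u′ = trans (ℤP.*-comm (+ 2) k) (trans (sym u′≡k*2) (ring u′ v′))
      where
      ring : ∀ u v → 1ℤ * u + 0ℤ * v ≡ u
      ring = solve-∀

  diag₁₂-attains : ∀ u v → ∃[ x ] ∃[ y ] evalF (L ∘F diag₁₂) x y ≡ evalF L u v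
  diag₁₂-attains u v with even-in-orbit 0ℤ 1ℤ u v
  ... | u′ , v′ , same , divides k v′≡k*2 = u′ , k , (begin
    evalF (L ∘F diag₁₂) u′ k ≡⟨ evalF-∘F-diag₁₂ L u′ k ⟩
    evalF L u′ (+ 2 * k)     ≡⟨ cong (evalF L u′) 2k≡v′ ⟩
    evalF L u′ v′            ≡⟨ same ⟩
    evalF L u v              ∎)
    where
    2k≡v′ : + 2 * k ≡ v′
    2k≡v′ = trans (ℤP.*-comm (+ 2) k) (trans (sym v′≡k*2) (ring u′ v′))
      where
      ring : ∀ u v → 0ℤ * u + 1ℤ * v ≡ v
      ring = solve-∀

  diag₁₂≅diag₂₁∘γ : ∃[ γ ] InGL2 γ × (L ∘F diag₁₂ ≡ (L ∘F diag₂₁) ∘F γ)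
  diag₁₂≅diag₂₁∘γ with parity a
  ... | inj₁ (divides a′ a≡a′*2)  = diag₁₂≅diag₂₁ L a′ (trans a≡a′*2 (ℤP.*-comm a′ (+ 2))) det≡1 L∘ρ≡L
  ... | inj₂ (divides q 1+a≡q*2) = diag₁₂≅diag₂₁ L (- q) e≡2*-q det-adj≡1 L∘adjρ≡L
    where
    e≡2*-q : e ≡ + 2 * - q
    e≡2*-q = begin
      e                          ≡⟨ isolate a e ⟩
      (a + e) + 1ℤ - (1ℤ + a)    ≡⟨ cong₂ (λ t o → t + 1ℤ - o) trace≡-1 1+a≡q*2 ⟩
      -1ℤ + 1ℤ - q * + 2         ≡⟨ ring q ⟩
      + 2 * - q                  ∎
      where
      isolate : ∀ a e → e ≡ (a + e) + 1ℤ - (1ℤ + a)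
      isolate = solve-∀
      ring : ∀ q → -1ℤ + 1ℤ - q * + 2 ≡ + 2 * - q
      ring = solve-∀
    det-adj≡1 : e * a - - b * - c ≡ 1ℤ
    det-adj≡1 = trans (ring a b c e) det≡1
      where
      ring : ∀ a b c e → e * a - - b * - c ≡ a * e - b * c
      ring = solve-∀

  -- (- r , p) is, up to the unit det γ, the second row of γ⁻¹.
  halving : ∀ γ → InGL2 γ → L ∘F diag₂₁ ≡ L ∘F γ →
            ∀ u v → ∃[ x ] ∃[ y ] evalF L u v ≡ evalF L (+ 2 * x) (+ 2 * y)
  halving γ@(mat p q r s) γ∈GL L∘diag₂₁≡L∘γ u v with even-in-orbit (- r) p u v
  ... | u′ , v′ , same , ℓ-even with ∣n⇒∣m*n (p * s - q * r) ℓ-even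
  ... | divides k y≡k*2 = x , k , (begin
    evalF L u v                  ≡⟨ same ⟨
    evalF L u′ v′                ≡⟨ ∘ₘ-GL-inverse (evalF L) γ γ∈GL u′ v′ ⟨
    (evalF L ∘ₘ γ) x y           ≡⟨ evalF-∘F L γ x y ⟨
    evalF (L ∘F γ) x y           ≡⟨ cong (λ M → evalF M x y) L∘diag₂₁≡L∘γ ⟨
    evalF (L ∘F diag₂₁) x y      ≡⟨ evalF-∘F-diag₂₁ L x y ⟩
    evalF L (+ 2 * x) y          ≡⟨ cong (evalF L (+ 2 * x)) (trans y≡k*2 (ℤP.*-comm k (+ 2))) ⟩
    evalF L (+ 2 * x) (+ 2 * k)  ∎)
    where
    x y : ℤ
    x = (p * s - q * r) * (s * u′ + - q * v′)
    y = (p * s - q * r) * (- r * u′ + p * v′)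

  diag₂₁-equivalent⇒evalF≡0 : ∀ {m} → length L ≡ suc (suc m) → (∃[ γ ] InGL2 γ × (L ∘F diag₂₁ ≡ L ∘F γ)) →
              ∀ u v → evalF L u v ≡ 0ℤ
  diag₂₁-equivalent⇒evalF≡0 {m} length≡2+m (γ , γ∈GL , L∘diag₂₁≡L∘γ) =
    Descent.vanishes (evalF L) m homogeneous (halving γ γ∈GL L∘diag₂₁≡L∘γ)
    where
    homogeneous : ∀ x y → evalF L (+ 2 * x) (+ 2 * y) ≡ (+ 2) ^ suc m * evalF L x y
    homogeneous x y = trans (evalF-homogeneous L (+ 2) x y) (cong (λ n → (+ 2) ^ ℕ.pred n * evalF L x y) length≡2+m)

lemma3p5 : (d : ℕ) → 3 ≤ d → (F : Vec ℤ (suc d)) → ¬ (disc F ≡ 0ℤ)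
    → (∃[ γ ] InGL2 γ × HasOrder3 γ × ((toList F ∘F γ) ≡ toList F))
    → SameValueSet (toList F) (toList F ∘F mat (+ 2) 0ℤ 0ℤ 1ℤ)
      × SameValueSet (toList F) (toList F ∘F mat 1ℤ 0ℤ 0ℤ (+ 2))
      × ¬ (∃[ γ ] InGL2 γ × ((toList F ∘F mat (+ 2) 0ℤ 0ℤ 1ℤ) ≡ (toList F ∘F γ)))
      × (∃[ γ ] InGL2 γ × ((toList F ∘F mat 1ℤ 0ℤ 0ℤ (+ 2)) ≡ ((toList F ∘F mat (+ 2) 0ℤ 0ℤ 1ℤ) ∘F γ)))
lemma3p5 (suc (suc d)) (s≤s (s≤s _)) F disc≢0 (ρ , ρ∈GL , ρ-order3 , L∘ρ≡L) =
  sameValues-∘F L diag₂₁ diag₂₁-attains ,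
  sameValues-∘F L diag₁₂ diag₁₂-attains ,
  (λ equivalence → disc≢0 (disc-zero F (coeff-replicate-0 F (L≡0 equivalence)))) ,
  diag₁₂≅diag₂₁∘γ
  where
  L : List ℤ
  L = toList F
  trace∧det : trace ρ ≡ -1ℤ × det₂ ρ ≡ 1ℤ
  trace∧det = order3⇒trace≡-1∧det≡1 ρ∈GL ρ-order3
  open Order3Automorphism L (proj₁ trace∧det) (proj₂ trace∧det) L∘ρ≡L
  L≡0 : (∃[ γ ] InGL2 γ × (L ∘F diag₂₁ ≡ L ∘F γ)) → L ≡ replicate (suc (suc (suc d))) 0ℤ
  L≡0 equivalence = trans (evalF≡0⇒replicate-0 L (diag₂₁-equivalent⇒evalF≡0 length-L equivalence)) (cong (λ n → replicate n 0ℤ) length-L)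
    where
    length-L : length L ≡ suc (suc (suc d))
    length-L = VecP.length-toList F
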